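{- Let $s\in\{\mathbf{f},\mathbf{i},\mathbf{li}\}$. There exist a PTRS $\mathcal{P}$ and signatures $\Sigma\subsetneq\Sigma'$ such that $\mathtt{PAST}(\xrightarrow{s}_{\mathcal{P}})$ holds when terms range over the signature $\Sigma$, but does not hold when terms range over $\Sigma'$.
   Context: Terms $\mathcal{T}$ are built from a (countable) signature and countable variables; a PTRS over a signature only uses symbols of that signature. $\mathrm{FDist}(A)$: finite multisets of pairs $(p:a)$, $0<p\le1$, probabilities summing to 1; $p\cdot\mu$ as usual. A PTRS is a countable set $\mathcal{P}$ of rules $\ell\to\mu$, $\ell$ non-variable, $\mu\in\mathrm{FDist}(\mathcal{T})$, variables of each term in $\mu$ among those of $\ell$. $t\xrightarrow{\mathbf{f}}_{\mathcal{P}}\{p_1:t_1,\dots,p_k:t_k\}$ iff $t|_\pi=\ell\sigma$, $t_j=t[r_j\sigma]_\pi$ for a position $\pi$, rule $\ell\to\{p_1:r_1,\dots,p_k:r_k\}$, substitution $\sigma$; innermost ($\xrightarrow{\mathbf{i}}_{\mathcal{P}}$) if all proper subterms of $\ell\sigma$ are normal forms (terms admitting no step); leftmost-innermost ($\xrightarrow{\mathbf{li}}_{\mathcal{P}}$) if innermost and there is no redex at a position parallel to and left of $\pi$. Lifting $\rightrightarrows$ of $\to$: smallest relation on multi-distributions with $\{1:t\}\rightrightarrows\{1:t\}$ for normal forms, $\{1:t\}\rightrightarrows\mu$ if $t\to\mu$, closed under $\bigcup_jp_j\cdot\mu_j\rightrightarrows\bigcup_jp_j\cdot\nu_j$ ($\sum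 p_j=1$). $|\mu|_\to$: total probability of normal forms in $\mu$. $\mathtt{PAST}(\to)$: every infinite $\rightrightarrows$-sequence $(\mu_n)$ with $\mu_0=\{1:t\}$ for a term $t$ satisfies $\sum_{n\ge0}(1-|\mu_n|_\to)<\infty$. -}

module Defs where

open import Data.Nat as ℕ using (ℕ; zero; suc)
open import Data.Fin using (Fin)
open import Data.List using (List; []; _∷_; _++_; map; concat; length; [_])
open import Data.List.Relation.Unary.All using (All)
open import Data.List.Relation.Unary.Any using (Any)
open import Data.List.Membership.Propositional using (_∈_)
open import Data.List.Relation.Binary.Permutation.Propositional using (_↭_)
open import Data.Maybe using (Maybe; just; nothing)
open import Data.Product using (Σ; ∃; _×_; _,_)
open import Data.Unit using (⊤)
open import Data.Empty using (⊥)
open import Data.Rational using (ℚ; 0ℚ; 1ℚ; _+_; _*_; _-_; _≤_; _<_)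
open import Relation.Nullary using (¬_)
open import Relation.Binary.PropositionalEquality using (_≡_; _≢_)

-- Function symbols are pairs (name , arity) with name, arity : ℕ
-- (a countable supply).  A signature is a set of such symbols.
Signature : Set₁
Signature = ℕ → ℕ → Set

_⊆Sig_ : Signature → Signature → Set
S ⊆Sig S' = ∀ f n → S f n → S' f n

_⊊Sig_ : Signature → Signature → Set
S ⊊Sig S' = S ⊆Sig S' × ∃ λ f → ∃ λ n → S' f n × ¬ S f n

data Term : Set where
  var : ℕ → Term
  fun : ℕ → List Term → Term

data WF (S : Signature) : Term → Set where
  wf-var : ∀ x → WF S (var x)
  wf-fun : ∀ f ts → S f (length ts) → All (WF S) ts → WF S (fun f ts)

_∈𝒯_ : Term → Signature → Set
t ∈𝒯 S = WF S t

data _occursIn_ (x : ℕ) : Term → Set where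
  here  : x occursIn var x
  there : ∀ {f ts} → Any (x occursIn_) ts → x occursIn fun f ts

Subst : Set
Subst = ℕ → Term

sub  : Subst → Term → Term
subs : Subst → List Term → List Term
sub σ (var x) = σ x
sub σ (fun f ts) = fun f (subs σ ts)
subs σ [] = []
subs σ (t ∷ ts) = sub σ t ∷ subs σ ts

Pos : Set
Pos = List ℕ

subtermAt : Term → Pos → Maybe Term
argAt     : List Term → ℕ → Pos → Maybe Term
subtermAt t [] = just t
subtermAt (var x) (i ∷ p) = nothing
subtermAt (fun f ts) (i ∷ p) = argAt ts i p
argAt [] i p = nothing
argAt (t ∷ ts) zero p = subtermAt t p
argAt (t ∷ ts) (suc i) p = argAt ts i p

-- t[u]_π  (only used when π is a position of t)
replaceAt  : Term → Pos → Term → Term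
replaceArg : List Term → ℕ → Pos → Term → List Term
replaceAt t [] u = u
replaceAt (var x) (i ∷ p) u = var x
replaceAt (fun f ts) (i ∷ p) u = fun f (replaceArg ts i p u)
replaceArg [] i p u = []
replaceArg (t ∷ ts) zero p u = replaceAt t p u ∷ ts
replaceArg (t ∷ ts) (suc i) p u = t ∷ replaceArg ts i p u

MDist : Set
MDist = List (ℚ × Term)

sumP : MDist → ℚ
sumP [] = 0ℚ
sumP ((p , _) ∷ μ) = p + sumP μ

IsFDist : MDist → Set
IsFDist μ = All (λ { (p , _) → (0ℚ < p) × (p ≤ 1ℚ) }) μ × sumP μ ≡ 1ℚ

_·_ : ℚ → MDist → MDist
p · μ = map (λ { (q , t) → (p * q , t) }) μ

record Rule : Set where
  constructor _⟶_
  field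
    lhs : Term
    rhs : MDist
open Rule public

-- a (countable) set of rules; Rule is itself a countable type
PTRS : Set₁
PTRS = Rule → Set

IsPTRS : PTRS → Set
IsPTRS P = ∀ ρ → P ρ →
    IsFDist (rhs ρ)
  × (∃ λ f → ∃ λ ts → lhs ρ ≡ fun f ts)
  × (∀ p r → (p , r) ∈ rhs ρ → ∀ x → x occursIn r → x occursIn lhs ρ)

OverSig : Signature → PTRS → Set
OverSig S P = ∀ ρ → P ρ → lhs ρ ∈𝒯 S × (∀ p r → (p , r) ∈ rhs ρ → r ∈𝒯 S)

data Strategy : Set where
  𝐟 𝐢 𝐥𝐢 : Strategy

StepAt : PTRS → Term → Pos → Rule → Subst → MDist → Set
StepAt P t π ρ σ μ =
    P ρ
  × subtermAt t π ≡ just (sub σ (lhs ρ))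
  × μ ≡ map (λ { (p , r) → (p , replaceAt t π (sub σ r)) }) (rhs ρ)

NF : PTRS → Term → Set
NF P t = ¬ (∃ λ π → ∃ λ ρ → ∃ λ σ → ∃ λ μ → StepAt P t π ρ σ μ)

Redex : PTRS → Term → Set
Redex P u = ∃ λ ρ → P ρ × ∃ λ σ → u ≡ sub σ (lhs ρ)

ProperSubtermsNF : PTRS → Term → Set
ProperSubtermsNF P u = ∀ π' v → π' ≢ [] → subtermAt u π' ≡ just v → NF P v

_LeftOf_ : Pos → Pos → Set
π' LeftOf π = ∃ λ κ → ∃ λ i → ∃ λ α → ∃ λ j → ∃ λ β →
  (i ℕ.< j) × (π' ≡ κ ++ (i ∷ α)) × (π ≡ κ ++ (j ∷ β))

NoRedexLeftOf : PTRS → Term → Pos → Set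
NoRedexLeftOf P t π = ∀ π' v → π' LeftOf π → subtermAt t π' ≡ just v → ¬ Redex P v

StratCond : Strategy → PTRS → Term → Pos → Rule → Subst → Set
StratCond 𝐟  P t π ρ σ = ⊤
StratCond 𝐢  P t π ρ σ = ProperSubtermsNF P (sub σ (lhs ρ))
StratCond 𝐥𝐢 P t π ρ σ = ProperSubtermsNF P (sub σ (lhs ρ)) × NoRedexLeftOf P t π

Step : Strategy → PTRS → Term → MDist → Set
Step s P t μ = ∃ λ π → ∃ λ ρ → ∃ λ σ → StepAt P t π ρ σ μ × StratCond s P t π ρ σ

sumFin : ∀ {k} → (Fin k → ℚ) → ℚ
sumFin {zero} p = 0ℚ
sumFin {suc k} p = p Fin.zero + sumFin (λ j → p (Fin.suc j))
  where import Data.Fin as Fin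

bigUnion : ∀ {k} → (Fin k → ℚ) → (Fin k → MDist) → MDist
bigUnion {zero} p μ = []
bigUnion {suc k} p μ = (p Fin.zero · μ Fin.zero) ++ bigUnion (λ j → p (Fin.suc j)) (λ j → μ (Fin.suc j))
  where import Data.Fin as Fin

-- the lifting ⇉ of —s→_P to multi-distributions (multisets: up to ↭)
data Lift (s : Strategy) (P : PTRS) : MDist → MDist → Set where
  lift-nf   : ∀ {t} → NF P t → Lift s P [ (1ℚ , t) ] [ (1ℚ , t) ]
  lift-step : ∀ {t μ} → Step s P t μ → Lift s P [ (1ℚ , t) ] μ
  lift-comb : ∀ {μ ν} (k : ℕ) (p : Fin k → ℚ) (μs νs : Fin k → MDist) →
              (∀ j → 0ℚ < p j) → sumFin p ≡ 1ℚ →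
              (∀ j → Lift s P (μs j) (νs j)) →
              μ ↭ bigUnion p μs → ν ↭ bigUnion p νs →
              Lift s P μ ν

data NFMass (P : PTRS) : MDist → ℚ → Set where
  m-nil : NFMass P [] 0ℚ
  m-nf  : ∀ {p t μ q} → NF P t → NFMass P μ q → NFMass P ((p , t) ∷ μ) (p + q)
  m-red : ∀ {p t μ q} → ¬ NF P t → NFMass P μ q → NFMass P ((p , t) ∷ μ) q

partialSum : (ℕ → ℚ) → ℕ → ℚ
partialSum q zero = 0ℚ
partialSum q (suc N) = partialSum q N + (1ℚ - q N)

-- PAST(—s→_P) with terms ranging over the signature S.
-- Series of nonnegative terms converges iff partial sums are bounded.
PAST : Strategy → PTRS → Signature → Set
PAST s P S = ∀ (t : Term) → t ∈𝒯 S → (μ : ℕ → MDist) →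
  μ 0 ≡ [ (1ℚ , t) ] → (∀ n → Lift s P (μ n) (μ (suc n))) →
  ∃ λ (B : ℚ) → ∀ (q : ℕ → ℚ) → (∀ n → NFMass P (μ n) (q n)) →
    ∀ N → partialSum q N ≤ B

{-# OPTIONS --safe #-}

-- Take the rules Z → {½:Z, ½:C₀}, A → {1:Cₙ} (for every n) and Cₙ₊₁ → {1:Cₙ}. Over constants,
-- every term is a variable or a constant, and the potential φ(Z) = 2, φ(Cₙ) = n decreases in
-- expectation, from the second step on, by at least the mass not yet in normal form; hence the
-- expected derivation length is at most 1 + 𝔼φ(μ₁).
-- Adding a binary symbol g breaks this: starting from g(Z, A), step j+1 spawns a copy g(C₀, A)
-- of probability 2^-(j+1) whose A the scheduler rewrites to C_(j·2^(j+1)). That copy stays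
-- reducible for j·2^(j+1) further steps and alone contributes j to the expected derivation
-- length, which is therefore infinite. Every step used is leftmost-innermost, so the same
-- derivation refutes PAST for all three strategies.

module Submission where

open import Defs
open import Data.Product using (∃; _×_)
open import Relation.Nullary using (¬_)

open import Data.Empty using (⊥-elim)
open import Data.Fin as Fin using (Fin)
import Data.Integer as ℤ
import Data.Integer.Properties as ℤP
open import Data.List using (List; []; _∷_; _++_; map; concatMap; length; lookup; [_])
open import Data.List.Membership.Propositional using (_∈_)
open import Data.List.Membership.Propositional.Properties using (∈-map⁺; ∈-lookup)
open import Data.List.Relation.Unary.All as All using (All; []; _∷_)
import Data.List.Relation.Unary.All.Properties as AllP
open import Data.List.Relation.Unary.Any using (here; there)
import Data.List.Relation.Binary.Permutation.Propositional as ↭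
open import Data.List.Relation.Binary.Permutation.Propositional using (_↭_; ↭-sym; ↭-reflexive)
open import Data.List.Relation.Binary.Permutation.Propositional.Properties using (All-resp-↭)
open import Data.Maybe using (just)
open import Data.Nat as ℕ using (ℕ; zero; suc; _∸_; _^_)
import Data.Nat.Properties as ℕP
open import Data.Product using (_,_; proj₁; proj₂; map₂; uncurry)
open import Data.Rational using (ℚ; 0ℚ; 1ℚ; ½; _+_; _*_; _-_; _≤_; _<_; mkℚ; toℚᵘ; nonNegative; positive)
import Data.Rational.Properties as ℚP
open import Algebra.Properties.Monoid.Mult ℚP.+-0-monoid using (×-assocˡ) renaming (_×_ to _×ℚ_)
open import Data.Rational.Solver using (module +-*-Solver)
import Data.Rational.Unnormalised as ℚᵘ
import Data.Rational.Unnormalised.Properties as ℚᵘP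
open import Data.Sum using (_⊎_; inj₁; inj₂)
open import Data.Unit using (tt)
open import Function using (_∘_)
open import Relation.Nullary using (Dec; yes; no)
open import Relation.Nullary.Decidable using (map′; toWitness)
open import Relation.Binary.PropositionalEquality
  using (_≡_; refl; sym; cong; cong₂; subst; module ≡-Reasoning) renaming (trans to ≡-trans)

open +-*-Solver using (solve; _:=_; _:+_; _:*_; _:-_; con)

0≤1 : 0ℚ ≤ 1ℚ
0≤1 = ℚP.<⇒≤ (ℚP.positive⁻¹ 1ℚ)

*-nonNeg : ∀ {a b} → 0ℚ ≤ a → 0ℚ ≤ b → 0ℚ ≤ a * b
*-nonNeg {a} {b} 0≤a 0≤b =
  ℚP.nonNegative⁻¹ (a * b) {{ℚP.nonNeg*nonNeg⇒nonNeg a {{nonNegative 0≤a}} b {{nonNegative 0≤b}}}}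

+-nonNeg : ∀ {a b} → 0ℚ ≤ a → 0ℚ ≤ b → 0ℚ ≤ a + b
+-nonNeg = ℚP.+-mono-≤

≤-+-nonNeg : ∀ a {b} → 0ℚ ≤ b → a ≤ a + b
≤-+-nonNeg a 0≤b = ℚP.≤-trans (ℚP.≤-reflexive (sym (ℚP.+-identityʳ a))) (ℚP.+-monoʳ-≤ a 0≤b)

×ℚ-nonNeg : ∀ n {x} → 0ℚ ≤ x → 0ℚ ≤ n ×ℚ x
×ℚ-nonNeg zero 0≤x = ℚP.≤-refl
×ℚ-nonNeg (suc n) 0≤x = +-nonNeg 0≤x (×ℚ-nonNeg n 0≤x)

n×1≃n : ∀ n → toℚᵘ (n ×ℚ 1ℚ) ℚᵘ.≃ ℚᵘ.mkℚᵘ (ℤ.+ n) 0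
n×1≃n zero = ℚᵘ.*≡* refl
n×1≃n (suc n) = ℚᵘP.≃-trans (ℚP.toℚᵘ-homo-+ 1ℚ (n ×ℚ 1ℚ))
  (ℚᵘP.≃-trans (ℚᵘP.+-congʳ (toℚᵘ 1ℚ) (n×1≃n n))
    (ℚᵘ.*≡* (cong (λ z → (ℤ.+ 1 ℤ.+ z) ℤ.* ℤ.+ 1) (ℤP.*-identityʳ (ℤ.+ n)))))

archimedean : ∀ B → ∃ λ n → B ≤ n ×ℚ 1ℚ
archimedean (mkℚ k d _) = ℤ.∣ k ∣ , ℚP.toℚᵘ-cancel-≤
  (ℚᵘP.≤-respʳ-≃ (ℚᵘP.≃-sym (n×1≃n ℤ.∣ k ∣)) (ℚᵘ.*≤* (k≤∣k∣·d k)))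
  where
  k≤∣k∣·d : ∀ k → k ℤ.* ℤ.+ 1 ℤ.≤ ℤ.+ ℤ.∣ k ∣ ℤ.* ℤ.+ suc d
  k≤∣k∣·d ℤ.-[1+ _ ] = ℤ.-≤+
  k≤∣k∣·d (ℤ.+ zero) = ℤ.+≤+ ℕ.z≤n
  k≤∣k∣·d (ℤ.+ suc k) = ℤ.+≤+ (ℕP.*-monoʳ-≤ (suc k) (ℕ.s≤s (ℕ.z≤n {d})))

half^ : ℕ → ℚ
half^ zero = 1ℚ
half^ (suc n) = ½ * half^ n

half^-pos : ∀ n → 0ℚ < half^ n
half^-pos zero = ℚP.positive⁻¹ 1ℚ
half^-pos (suc n) =
  ℚP.positive⁻¹ (½ * half^ n) {{ℚP.pos*pos⇒pos ½ (half^ n) {{positive (half^-pos n)}}}}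

2^n×half^n : ∀ n → (2 ^ n) ×ℚ half^ n ≡ 1ℚ
2^n×half^n zero = refl
2^n×half^n (suc n) = begin
  (2 ℕ.* 2 ^ n) ×ℚ (½ * half^ n)   ≡⟨ cong (_×ℚ (½ * half^ n)) (ℕP.*-comm 2 (2 ^ n)) ⟩
  (2 ^ n ℕ.* 2) ×ℚ (½ * half^ n)   ≡⟨ sym (×-assocˡ (½ * half^ n) (2 ^ n) 2) ⟩
  (2 ^ n) ×ℚ (2 ×ℚ (½ * half^ n))  ≡⟨ cong ((2 ^ n) ×ℚ_) (two-halves (half^ n)) ⟩
  (2 ^ n) ×ℚ half^ n               ≡⟨ 2^n×half^n n ⟩
  1ℚ                               ∎
  where
  open ≡-Reasoning
  two-halves : ∀ h → ½ * h + (½ * h + 0ℚ) ≡ h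
  two-halves = solve 1 (λ h → con ½ :* h :+ (con ½ :* h :+ con 0ℚ) := h) refl

partialSum-nonNeg : ∀ q → (∀ n → 0ℚ ≤ 1ℚ - q n) → ∀ N → 0ℚ ≤ partialSum q N
partialSum-nonNeg q terms≥0 zero = ℚP.≤-refl
partialSum-nonNeg q terms≥0 (suc N) = +-nonNeg (partialSum-nonNeg q terms≥0 N) (terms≥0 N)

partialSum-≤-potential : ∀ (q Φ : ℕ → ℚ) → (∀ n → 0ℚ ≤ Φ n) → 1ℚ - q 0 ≤ 1ℚ →
  (∀ n → Φ (suc (suc n)) + (1ℚ - q (suc n)) ≤ Φ (suc n)) →
  ∀ N → partialSum q N ≤ 1ℚ + Φ 1
partialSum-≤-potential q Φ Φ≥0 first decrease zero = +-nonNeg 0≤1 (Φ≥0 1)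
partialSum-≤-potential q Φ Φ≥0 first decrease (suc N) =
  ℚP.≤-trans (≤-+-nonNeg (partialSum q (suc N)) (Φ≥0 (suc N))) (invariant N)
  where
  open ℚP.≤-Reasoning
  invariant : ∀ N → partialSum q (suc N) + Φ (suc N) ≤ 1ℚ + Φ 1
  invariant zero = ℚP.+-monoˡ-≤ (Φ 1) (ℚP.≤-trans (ℚP.≤-reflexive (ℚP.+-identityˡ _)) first)
  invariant (suc N) = begin
    (partialSum q (suc N) + (1ℚ - q (suc N))) + Φ (suc (suc N))
      ≡⟨ solve 3 (λ s c φ → (s :+ c) :+ φ := s :+ (φ :+ c)) refl
           (partialSum q (suc N)) (1ℚ - q (suc N)) (Φ (suc (suc N))) ⟩
    partialSum q (suc N) + (Φ (suc (suc N)) + (1ℚ - q (suc N)))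
      ≤⟨ ℚP.+-monoʳ-≤ (partialSum q (suc N)) (decrease N) ⟩
    partialSum q (suc N) + Φ (suc N)
      ≤⟨ invariant N ⟩
    1ℚ + Φ 1 ∎

partialSum-≥-plateau : ∀ q {ε} L K → (∀ n → 0ℚ ≤ 1ℚ - q n) →
  (∀ a → a ℕ.≤ L → ε ≤ 1ℚ - q (a ℕ.+ K)) → suc L ×ℚ ε ≤ partialSum q (suc L ℕ.+ K)
partialSum-≥-plateau q {ε} zero K terms≥0 plateau = begin
  ε + 0ℚ                        ≡⟨ ℚP.+-identityʳ ε ⟩
  ε                             ≡⟨ sym (ℚP.+-identityˡ ε) ⟩
  0ℚ + ε                        ≤⟨ ℚP.+-mono-≤ (partialSum-nonNeg q terms≥0 K) (plateau 0 ℕ.z≤n) ⟩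
  partialSum q K + (1ℚ - q K)   ∎
  where open ℚP.≤-Reasoning
partialSum-≥-plateau q {ε} (suc L) K terms≥0 plateau = begin
  ε + suc L ×ℚ ε
    ≡⟨ ℚP.+-comm ε _ ⟩
  suc L ×ℚ ε + ε
    ≤⟨ ℚP.+-mono-≤ (partialSum-≥-plateau q L K terms≥0 (λ a a≤L → plateau a (ℕP.m≤n⇒m≤1+n a≤L)))
                   (plateau (suc L) ℕP.≤-refl) ⟩
  partialSum q (suc L ℕ.+ K) + (1ℚ - q (suc L ℕ.+ K)) ∎
  where open ℚP.≤-Reasoning

sumFin-cong : ∀ {k} {f g : Fin k → ℚ} → (∀ j → f j ≡ g j) → sumFin f ≡ sumFin g
sumFin-cong {zero} f≡g = refl
sumFin-cong {suc k} f≡g = cong₂ _+_ (f≡g Fin.zero) (sumFin-cong (f≡g ∘ Fin.suc))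

sumFin-+ : ∀ {k} (f g : Fin k → ℚ) → sumFin (λ j → f j + g j) ≡ sumFin f + sumFin g
sumFin-+ {zero} f g = refl
sumFin-+ {suc k} f g = ≡-trans (cong ((f Fin.zero + g Fin.zero) +_) (sumFin-+ (f ∘ Fin.suc) (g ∘ Fin.suc)))
  (solve 4 (λ a b c d → (a :+ b) :+ (c :+ d) := (a :+ c) :+ (b :+ d)) refl
    (f Fin.zero) (g Fin.zero) (sumFin (f ∘ Fin.suc)) (sumFin (g ∘ Fin.suc)))

sumFin-mono : ∀ {k} {f g : Fin k → ℚ} → (∀ j → f j ≤ g j) → sumFin f ≤ sumFin g
sumFin-mono {zero} f≤g = ℚP.≤-refl
sumFin-mono {suc k} f≤g = ℚP.+-mono-≤ (f≤g Fin.zero) (sumFin-mono (f≤g ∘ Fin.suc))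

𝔼 : (Term → ℚ) → MDist → ℚ
𝔼 f [] = 0ℚ
𝔼 f ((p , t) ∷ μ) = p * f t + 𝔼 f μ

𝔼-singleton : ∀ f t → 𝔼 f [ (1ℚ , t) ] ≡ f t
𝔼-singleton f t = ≡-trans (ℚP.+-identityʳ _) (ℚP.*-identityˡ (f t))

sumP≡𝔼1 : ∀ μ → sumP μ ≡ 𝔼 (λ _ → 1ℚ) μ
sumP≡𝔼1 [] = refl
sumP≡𝔼1 ((p , _) ∷ μ) = cong₂ _+_ (sym (ℚP.*-identityʳ p)) (sumP≡𝔼1 μ)

sumP-map-terms : ∀ (f : ℚ × Term → ℚ × Term) → (∀ x → proj₁ (f x) ≡ proj₁ x) →
  ∀ μ → sumP (map f μ) ≡ sumP μ
sumP-map-terms f keeps [] = refl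
sumP-map-terms f keeps (x ∷ μ) = cong₂ _+_ (keeps x) (sumP-map-terms f keeps μ)

𝔼-++ : ∀ f μ ν → 𝔼 f (μ ++ ν) ≡ 𝔼 f μ + 𝔼 f ν
𝔼-++ f [] ν = sym (ℚP.+-identityˡ _)
𝔼-++ f ((p , t) ∷ μ) ν =
  ≡-trans (cong (p * f t +_) (𝔼-++ f μ ν)) (sym (ℚP.+-assoc (p * f t) (𝔼 f μ) (𝔼 f ν)))

𝔼-· : ∀ f p μ → 𝔼 f (p · μ) ≡ p * 𝔼 f μ
𝔼-· f p [] = sym (ℚP.*-zeroʳ p)
𝔼-· f p ((q , t) ∷ μ) =
  ≡-trans (cong₂ _+_ (ℚP.*-assoc p q (f t)) (𝔼-· f p μ)) (sym (ℚP.*-distribˡ-+ p (q * f t) (𝔼 f μ)))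

𝔼-↭ : ∀ f {μ ν} → μ ↭ ν → 𝔼 f μ ≡ 𝔼 f ν
𝔼-↭ f ↭.refl = refl
𝔼-↭ f (↭.prep (p , t) μ↭ν) = cong (p * f t +_) (𝔼-↭ f μ↭ν)
𝔼-↭ f (↭.swap (p , t) (q , u) μ↭ν) =
  ≡-trans (cong (λ e → p * f t + (q * f u + e)) (𝔼-↭ f μ↭ν))
    (solve 3 (λ x y e → x :+ (y :+ e) := y :+ (x :+ e)) refl (p * f t) (q * f u) _)
𝔼-↭ f (↭.trans μ↭ν ν↭ρ) = ≡-trans (𝔼-↭ f μ↭ν) (𝔼-↭ f ν↭ρ)

𝔼-bigUnion : ∀ {k} f (p : Fin k → ℚ) μs → 𝔼 f (bigUnion p μs) ≡ sumFin (λ j → p j * 𝔼 f (μs j))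
𝔼-bigUnion {zero} f p μs = refl
𝔼-bigUnion {suc k} f p μs = ≡-trans (𝔼-++ f (p Fin.zero · μs Fin.zero) _)
  (cong₂ _+_ (𝔼-· f (p Fin.zero) (μs Fin.zero)) (𝔼-bigUnion f (p ∘ Fin.suc) (μs ∘ Fin.suc)))

𝔼-comb : ∀ {k} f (p : Fin k → ℚ) μs {μ} → μ ↭ bigUnion p μs →
  𝔼 f μ ≡ sumFin (λ j → p j * 𝔼 f (μs j))
𝔼-comb f p μs μ↭ = ≡-trans (𝔼-↭ f μ↭) (𝔼-bigUnion f p μs)

NonNegProbs : MDist → Set
NonNegProbs = All ((0ℚ ≤_) ∘ proj₁)

𝔼-nonNeg : ∀ f μ → NonNegProbs μ → (∀ t → 0ℚ ≤ f t) → 0ℚ ≤ 𝔼 f μ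
𝔼-nonNeg f [] [] f≥0 = ℚP.≤-refl
𝔼-nonNeg f ((p , t) ∷ μ) (p≥0 ∷ μ≥0) f≥0 = +-nonNeg (*-nonNeg p≥0 (f≥0 t)) (𝔼-nonNeg f μ μ≥0 f≥0)

𝔼-≥-member : ∀ f μ {p t} → NonNegProbs μ → (∀ t → 0ℚ ≤ f t) → (p , t) ∈ μ → p * f t ≤ 𝔼 f μ
𝔼-≥-member f ((p , t) ∷ μ) (_ ∷ μ≥0) f≥0 (here refl) = ≤-+-nonNeg (p * f t) (𝔼-nonNeg f μ μ≥0 f≥0)
𝔼-≥-member f ((p′ , t′) ∷ μ) (p′≥0 ∷ μ≥0) f≥0 (there ∈μ) = ℚP.≤-trans
  (ℚP.≤-trans (ℚP.≤-reflexive (sym (ℚP.+-identityˡ _))) (ℚP.+-monoˡ-≤ _ (*-nonNeg p′≥0 (f≥0 t′))))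
  (ℚP.+-monoʳ-≤ (p′ * f t′) (𝔼-≥-member f μ μ≥0 f≥0 ∈μ))

AllTerms : (Term → Set) → MDist → Set
AllTerms Q = All (Q ∘ proj₂)

module _ {k} (p : Fin k → ℚ) (μs : Fin k → MDist) {μ : MDist} (μ↭ : μ ↭ bigUnion p μs) where

  AllTerms-components : ∀ {Q} → AllTerms Q μ → ∀ j → AllTerms Q (μs j)
  AllTerms-components = components p μs ∘ All-resp-↭ μ↭
    where
    components : ∀ {k Q} (p : Fin k → ℚ) μs → AllTerms Q (bigUnion p μs) → ∀ j → AllTerms Q (μs j)
    components p μs Qμ Fin.zero = AllP.map⁻ (AllP.++⁻ˡ (p Fin.zero · μs Fin.zero) Qμ)
    components p μs Qμ (Fin.suc j) =
      components (p ∘ Fin.suc) (μs ∘ Fin.suc) (AllP.++⁻ʳ (p Fin.zero · μs Fin.zero) Qμ) j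

  AllTerms-combine : ∀ {Q} → (∀ j → AllTerms Q (μs j)) → AllTerms Q μ
  AllTerms-combine = All-resp-↭ (↭-sym μ↭) ∘ combine p μs
    where
    combine : ∀ {k Q} (p : Fin k → ℚ) μs → (∀ j → AllTerms Q (μs j)) → AllTerms Q (bigUnion p μs)
    combine {zero} p μs Qμs = []
    combine {suc k} p μs Qμs =
      AllP.++⁺ (AllP.map⁺ (Qμs Fin.zero)) (combine (p ∘ Fin.suc) (μs ∘ Fin.suc) (Qμs ∘ Fin.suc))

  NonNegProbs-combine : (∀ j → 0ℚ ≤ p j) → (∀ j → NonNegProbs (μs j)) → NonNegProbs μ
  NonNegProbs-combine p≥0 = All-resp-↭ (↭-sym μ↭) ∘ combine p μs p≥0
    where
    combine : ∀ {k} (p : Fin k → ℚ) μs → (∀ j → 0ℚ ≤ p j) → (∀ j → NonNegProbs (μs j)) →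
      NonNegProbs (bigUnion p μs)
    combine {zero} p μs p≥0 μs≥0 = []
    combine {suc k} p μs p≥0 μs≥0 =
      AllP.++⁺ (AllP.map⁺ (All.map (*-nonNeg (p≥0 Fin.zero)) (μs≥0 Fin.zero)))
               (combine (p ∘ Fin.suc) (μs ∘ Fin.suc) (p≥0 ∘ Fin.suc) (μs≥0 ∘ Fin.suc))

module _ {P : PTRS} where

  -- The target is spelled out because it cannot be inferred: the pattern lambda in StepAt
  -- mentions μ itself, so solving μ ≡ map … μ fails the occurs check.
  redexAt⇒¬NF : ∀ {t π u} → subtermAt t π ≡ just u → Redex P u → ¬ NF P t
  redexAt⇒¬NF {t} {π} t|π≡u (ρ , Pρ , σ , refl) nf =
    nf (π , ρ , σ , map (λ (p , r) → p , replaceAt t π (sub σ r)) (rhs ρ) , Pρ , t|π≡u , refl)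

  RedexFree : Term → Set
  RedexFree t = ∀ π u → subtermAt t π ≡ just u → ¬ Redex P u

  ArgsRedexFree : List Term → Set
  ArgsRedexFree ts = ∀ i π u → argAt ts i π ≡ just u → ¬ Redex P u

  module _ (redex? : ∀ u → Dec (Redex P u)) where

    redexFree? : ∀ t → Dec (RedexFree t)
    argsRedexFree? : ∀ ts → Dec (ArgsRedexFree ts)
    redexFree? (var x) with redex? (var x)
    ... | yes r = no λ free → free [] _ refl r
    ... | no ¬r = yes λ { [] u refl → ¬r ; (_ ∷ _) u () }
    redexFree? (fun f ts) with redex? (fun f ts) | argsRedexFree? ts
    ... | yes r | _ = no λ free → free [] _ refl r
    ... | no _ | no ¬args = no λ free → ¬args λ i π → free (i ∷ π)
    ... | no ¬r | yes args = yes λ { [] u refl → ¬r ; (i ∷ π) → args i π }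
    argsRedexFree? [] = yes λ _ _ _ ()
    argsRedexFree? (t ∷ ts) with redexFree? t | argsRedexFree? ts
    ... | no ¬t | _ = no λ args → ¬t (args 0)
    ... | yes _ | no ¬ts = no λ args → ¬ts (args ∘ suc)
    ... | yes t | yes ts = yes λ { zero → t ; (suc i) → ts i }

    nf? : ∀ t → Dec (NF P t)
    nf? t = map′ (λ { free (π , ρ , σ , _ , Pρ , t|π≡ , _) → free π _ t|π≡ (ρ , Pρ , σ , refl) })
                 (λ nf π u t|π≡u r → redexAt⇒¬NF {π = π} t|π≡u r nf)
                 (redexFree? t)

  constant-ProperSubtermsNF : ∀ f → ProperSubtermsNF P (fun f [])
  constant-ProperSubtermsNF f [] v []≢[] _ = ⊥-elim ([]≢[] refl)
  constant-ProperSubtermsNF f (_ ∷ _) v _ ()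

  ¬LeftOf-[0] : ∀ {π′} → ¬ (π′ LeftOf (0 ∷ []))
  ¬LeftOf-[0] ([] , _ , _ , _ , _ , () , _ , refl)
  ¬LeftOf-[0] ((_ ∷ []) , _ , _ , _ , _ , _ , _ , ())
  ¬LeftOf-[0] ((_ ∷ _ ∷ _) , _ , _ , _ , _ , _ , _ , ())

  LeftOf-[1] : ∀ {π′} → π′ LeftOf (1 ∷ []) → ∃ λ α → π′ ≡ 0 ∷ α
  LeftOf-[1] ([] , zero , α , _ , _ , _ , refl , refl) = α , refl
  LeftOf-[1] ([] , suc _ , _ , _ , _ , ℕ.s≤s () , _ , refl)
  LeftOf-[1] ((_ ∷ []) , _ , _ , _ , _ , _ , _ , ())
  LeftOf-[1] ((_ ∷ _ ∷ _) , _ , _ , _ , _ , _ , _ , ())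

  NoRedexLeftOf-1st : ∀ {f x y} → NoRedexLeftOf P (fun f (x ∷ y ∷ [])) (0 ∷ [])
  NoRedexLeftOf-1st π′ v left = ⊥-elim (¬LeftOf-[0] left)

  NoRedexLeftOf-2nd : ∀ {f x y} → NF P x → NoRedexLeftOf P (fun f (x ∷ y ∷ [])) (1 ∷ [])
  NoRedexLeftOf-2nd nf π′ v left t|π′≡v r with LeftOf-[1] left
  ... | α , refl = redexAt⇒¬NF {π = α} t|π′≡v r nf

  Step-𝐥𝐢⇒ : ∀ s {t μ} → Step 𝐥𝐢 P t μ → Step s P t μ
  Step-𝐥𝐢⇒ 𝐟 (π , ρ , σ , step , _) = π , ρ , σ , step , tt
  Step-𝐥𝐢⇒ 𝐢 (π , ρ , σ , step , innermost , _) = π , ρ , σ , step , innermost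
  Step-𝐥𝐢⇒ 𝐥𝐢 step = step

module _ {s : Strategy} {P : PTRS} where

  Lift-nonNegProbs : ∀ {μ ν} → Lift s P μ ν → NonNegProbs μ
  Lift-nonNegProbs (lift-nf _) = 0≤1 ∷ []
  Lift-nonNegProbs (lift-step _) = 0≤1 ∷ []
  Lift-nonNegProbs (lift-comb _ p μs _ p>0 _ lifts μ↭ _) =
    NonNegProbs-combine p μs μ↭ (ℚP.<⇒≤ ∘ p>0) (Lift-nonNegProbs ∘ lifts)

  Lift-sumP : IsPTRS P → ∀ {μ ν} → Lift s P μ ν → sumP μ ≡ sumP ν
  Lift-sumP isP (lift-nf _) = refl
  Lift-sumP isP (lift-step {μ = ν} (_ , ρ , _ , (Pρ , _ , ν≡) , _)) = sym (begin
    sumP ν                ≡⟨ cong sumP ν≡ ⟩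
    sumP (map _ (rhs ρ))  ≡⟨ sumP-map-terms _ (λ _ → refl) (rhs ρ) ⟩
    sumP (rhs ρ)          ≡⟨ proj₂ (proj₁ (isP ρ Pρ)) ⟩
    1ℚ                    ∎)
    where open ≡-Reasoning
  Lift-sumP isP {μ} {ν} (lift-comb _ p μs νs _ _ lifts μ↭ ν↭) = begin
    sumP μ                                               ≡⟨ sumP≡𝔼1 μ ⟩
    𝔼 (λ _ → 1ℚ) μ                                       ≡⟨ 𝔼-comb _ p μs μ↭ ⟩
    sumFin (λ j → p j * 𝔼 (λ _ → 1ℚ) (μs j))             ≡⟨ sumFin-cong (cong (p _ *_) ∘ mass-preserved) ⟩
    sumFin (λ j → p j * 𝔼 (λ _ → 1ℚ) (νs j))             ≡⟨ 𝔼-comb _ p νs ν↭ ⟨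
    𝔼 (λ _ → 1ℚ) ν                                       ≡⟨ sumP≡𝔼1 ν ⟨
    sumP ν                                               ∎
    where
    open ≡-Reasoning
    mass-preserved : ∀ j → 𝔼 (λ _ → 1ℚ) (μs j) ≡ 𝔼 (λ _ → 1ℚ) (νs j)
    mass-preserved j = ≡-trans (sym (sumP≡𝔼1 (μs j))) (≡-trans (Lift-sumP isP (lifts j)) (sumP≡𝔼1 (νs j)))

  sumP-along : IsPTRS P → ∀ {μ : ℕ → MDist} → (∀ n → Lift s P (μ n) (μ (suc n))) →
    sumP (μ 0) ≡ 1ℚ → ∀ n → sumP (μ n) ≡ 1ℚ
  sumP-along isP lifts μ₀≡1 zero = μ₀≡1
  sumP-along isP lifts μ₀≡1 (suc n) = ≡-trans (sym (Lift-sumP isP (lifts n))) (sumP-along isP lifts μ₀≡1 n)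

  Lift-AllTerms : ∀ {Q R : Term → Set} →
    (∀ {t} → Q t → NF P t → R t) → (∀ {t ν} → Q t → Step s P t ν → AllTerms R ν) →
    ∀ {μ ν} → Lift s P μ ν → AllTerms Q μ → AllTerms R ν
  Lift-AllTerms nf-case step-case (lift-nf nf) (Qt ∷ []) = nf-case Qt nf ∷ []
  Lift-AllTerms nf-case step-case (lift-step step) (Qt ∷ []) = step-case Qt step
  Lift-AllTerms nf-case step-case (lift-comb _ p μs νs _ _ lifts μ↭ ν↭) Qμ =
    AllTerms-combine p νs ν↭ λ j →
      Lift-AllTerms nf-case step-case (lifts j) (AllTerms-components p μs μ↭ Qμ j)

  Lift-𝔼-decrease : ∀ {Q : Term → Set} (φ c : Term → ℚ) →
    (∀ {t} → Q t → NF P t → c t ≤ 0ℚ) →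
    (∀ {t ν} → Q t → Step s P t ν → 𝔼 φ ν + c t ≤ φ t) →
    ∀ {μ ν} → Lift s P μ ν → AllTerms Q μ → 𝔼 φ ν + 𝔼 c μ ≤ 𝔼 φ μ
  Lift-𝔼-decrease φ c nf-case step-case (lift-nf {t} nf) (Qt ∷ []) = begin
    𝔼 φ [ (1ℚ , t) ] + 𝔼 c [ (1ℚ , t) ]   ≡⟨ cong (𝔼 φ [ (1ℚ , t) ] +_) (𝔼-singleton c t) ⟩
    𝔼 φ [ (1ℚ , t) ] + c t                ≤⟨ ℚP.+-monoʳ-≤ (𝔼 φ [ (1ℚ , t) ]) (nf-case Qt nf) ⟩
    𝔼 φ [ (1ℚ , t) ] + 0ℚ                 ≡⟨ ℚP.+-identityʳ _ ⟩
    𝔼 φ [ (1ℚ , t) ]                      ∎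
    where open ℚP.≤-Reasoning
  Lift-𝔼-decrease φ c nf-case step-case (lift-step {t} {ν} step) (Qt ∷ []) = begin
    𝔼 φ ν + 𝔼 c [ (1ℚ , t) ]              ≡⟨ cong (𝔼 φ ν +_) (𝔼-singleton c t) ⟩
    𝔼 φ ν + c t                           ≤⟨ step-case Qt step ⟩
    φ t                                   ≡⟨ 𝔼-singleton φ t ⟨
    𝔼 φ [ (1ℚ , t) ]                      ∎
    where open ℚP.≤-Reasoning
  Lift-𝔼-decrease φ c nf-case step-case {μ} {ν} (lift-comb _ p μs νs p>0 _ lifts μ↭ ν↭) Qμ = begin
    𝔼 φ ν + 𝔼 c μ
      ≡⟨ cong₂ _+_ (𝔼-comb φ p νs ν↭) (𝔼-comb c p μs μ↭) ⟩
    sumFin (λ j → p j * 𝔼 φ (νs j)) + sumFin (λ j → p j * 𝔼 c (μs j))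
      ≡⟨ sumFin-+ (λ j → p j * 𝔼 φ (νs j)) (λ j → p j * 𝔼 c (μs j)) ⟨
    sumFin (λ j → p j * 𝔼 φ (νs j) + p j * 𝔼 c (μs j))
      ≡⟨ sumFin-cong (λ j → ℚP.*-distribˡ-+ (p j) _ _) ⟨
    sumFin (λ j → p j * (𝔼 φ (νs j) + 𝔼 c (μs j)))
      ≤⟨ sumFin-mono (λ j → ℚP.*-monoˡ-≤-nonNeg (p j) {{nonNegative (ℚP.<⇒≤ (p>0 j))}}
           (Lift-𝔼-decrease φ c nf-case step-case (lifts j) (AllTerms-components p μs μ↭ Qμ j))) ⟩
    sumFin (λ j → p j * 𝔼 φ (μs j))
      ≡⟨ 𝔼-comb φ p μs μ↭ ⟨
    𝔼 φ μ ∎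
    where open ℚP.≤-Reasoning

  Lift-mixture : ∀ {I : Set} (l : List I) (p : I → ℚ) (t : I → Term) (ν : I → MDist) →
    All ((0ℚ <_) ∘ p) l → sumP (map (λ i → p i , t i) l) ≡ 1ℚ →
    All (λ i → Lift s P [ (1ℚ , t i) ] (ν i)) l →
    Lift s P (map (λ i → p i , t i) l) (concatMap (λ i → p i · ν i) l)
  Lift-mixture l p t ν p>0 sum≡1 lifts =
    lift-comb (length l) (p ∘ lookup l) (λ j → [ (1ℚ , t (lookup l j)) ]) (ν ∘ lookup l)
      (λ j → All.lookup p>0 (∈-lookup j)) (≡-trans (sumFin-lookup l) sum≡1)
      (λ j → All.lookup lifts (∈-lookup j)) (↭-reflexive (source l)) (↭-reflexive (target l))
    where
    sumFin-lookup : ∀ l → sumFin (p ∘ lookup l) ≡ sumP (map (λ i → p i , t i) l)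
    sumFin-lookup [] = refl
    sumFin-lookup (i ∷ l) = cong (p i +_) (sumFin-lookup l)
    source : ∀ l → map (λ i → p i , t i) l ≡ bigUnion (p ∘ lookup l) (λ j → [ (1ℚ , t (lookup l j)) ])
    source [] = refl
    source (i ∷ l) = cong₂ _∷_ (cong (_, t i) (sym (ℚP.*-identityʳ (p i)))) (source l)
    target : ∀ l → concatMap (λ i → p i · ν i) l ≡ bigUnion (p ∘ lookup l) (ν ∘ lookup l)
    target [] = refl
    target (i ∷ l) = cong (p i · ν i ++_) (target l)

module _ {P : PTRS} (nf? : ∀ t → Dec (NF P t)) where

  reducible : Term → ℚ
  reducible t with nf? t
  ... | yes _ = 0ℚ
  ... | no _ = 1ℚ

  reducible-NF : ∀ {t} → NF P t → reducible t ≡ 0ℚ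
  reducible-NF {t} nf with nf? t
  ... | yes _ = refl
  ... | no ¬nf = ⊥-elim (¬nf nf)

  reducible-¬NF : ∀ {t} → ¬ NF P t → reducible t ≡ 1ℚ
  reducible-¬NF {t} ¬nf with nf? t
  ... | yes nf = ⊥-elim (¬nf nf)
  ... | no _ = refl

  reducible-nonNeg : ∀ t → 0ℚ ≤ reducible t
  reducible-nonNeg t with nf? t
  ... | yes _ = ℚP.≤-refl
  ... | no _ = 0≤1

  reducible-≤1 : ∀ t → reducible t ≤ 1ℚ
  reducible-≤1 t with nf? t
  ... | yes _ = 0≤1
  ... | no _ = ℚP.≤-refl

  NFMass-total : ∀ μ → ∃ (NFMass P μ)
  NFMass-total [] = _ , m-nil
  NFMass-total ((p , t) ∷ μ) with nf? t | NFMass-total μ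
  ... | yes nf | _ , m = _ , m-nf nf m
  ... | no ¬nf | _ , m = _ , m-red ¬nf m

  NFMass+𝔼reducible : ∀ {μ q} → NFMass P μ q → q + 𝔼 reducible μ ≡ sumP μ
  NFMass+𝔼reducible m-nil = refl
  NFMass+𝔼reducible (m-nf {p} {t} {μ} {q} nf m) = begin
    (p + q) + (p * reducible t + 𝔼 reducible μ)
      ≡⟨ cong (λ r → (p + q) + (p * r + 𝔼 reducible μ)) (reducible-NF nf) ⟩
    (p + q) + (p * 0ℚ + 𝔼 reducible μ)
      ≡⟨ solve 3 (λ p q e → (p :+ q) :+ (p :* con 0ℚ :+ e) := p :+ (q :+ e)) refl p q _ ⟩
    p + (q + 𝔼 reducible μ)
      ≡⟨ cong (p +_) (NFMass+𝔼reducible m) ⟩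
    p + sumP μ ∎
    where open ≡-Reasoning
  NFMass+𝔼reducible (m-red {p} {t} {μ} {q} ¬nf m) = begin
    q + (p * reducible t + 𝔼 reducible μ)
      ≡⟨ cong (λ r → q + (p * r + 𝔼 reducible μ)) (reducible-¬NF ¬nf) ⟩
    q + (p * 1ℚ + 𝔼 reducible μ)
      ≡⟨ solve 3 (λ p q e → q :+ (p :* con 1ℚ :+ e) := p :+ (q :+ e)) refl p q _ ⟩
    p + (q + 𝔼 reducible μ)
      ≡⟨ cong (p +_) (NFMass+𝔼reducible m) ⟩
    p + sumP μ ∎
    where open ≡-Reasoning

  1-NFMass≡𝔼reducible : ∀ {μ q} → NFMass P μ q → sumP μ ≡ 1ℚ → 1ℚ - q ≡ 𝔼 reducible μ
  1-NFMass≡𝔼reducible {μ} {q} m sum≡1 = begin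
    1ℚ - q                       ≡⟨ cong (_- q) (≡-trans (sym sum≡1) (sym (NFMass+𝔼reducible m))) ⟩
    (q + 𝔼 reducible μ) - q      ≡⟨ solve 2 (λ q e → (q :+ e) :- q := e) refl q _ ⟩
    𝔼 reducible μ                ∎
    where open ≡-Reasoning

Z A : Term
Z = fun 0 []
A = fun 1 []

C : ℕ → Term
C n = fun (suc (suc n)) []

-- A symbol is a name together with its arity, so g = (0 , 2) and Z = (0 , 0) are different symbols.
g : Term → Term → Term
g x y = fun 0 (x ∷ y ∷ [])

data 𝒫 : Rule → Set where
  Z⟶ : 𝒫 (Z ⟶ ((½ , Z) ∷ (½ , C 0) ∷ []))
  A⟶ : ∀ n → 𝒫 (A ⟶ [ (1ℚ , C n) ])
  C⟶ : ∀ n → 𝒫 (C (suc n) ⟶ [ (1ℚ , C n) ])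

Constants : Signature
Constants _ n = n ≡ 0

ConstantsAndBinary : Signature
ConstantsAndBinary _ n = n ≡ 0 ⊎ n ≡ 2

Constants⊊ConstantsAndBinary : Constants ⊊Sig ConstantsAndBinary
Constants⊊ConstantsAndBinary = (λ _ _ → inj₁) , 0 , 2 , inj₂ refl , λ ()

IsConstant : Term → Set
IsConstant u = ∃ λ f → u ≡ fun f []

𝒫-lhs-constant : ∀ {ρ} → 𝒫 ρ → IsConstant (lhs ρ)
𝒫-lhs-constant Z⟶ = _ , refl
𝒫-lhs-constant (A⟶ _) = _ , refl
𝒫-lhs-constant (C⟶ _) = _ , refl

𝒫-rhs-constant : ∀ {ρ p r} → 𝒫 ρ → (p , r) ∈ rhs ρ → IsConstant r
𝒫-rhs-constant Z⟶ (here refl) = _ , refl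
𝒫-rhs-constant Z⟶ (there (here refl)) = _ , refl
𝒫-rhs-constant Z⟶ (there (there ()))
𝒫-rhs-constant (A⟶ _) (here refl) = _ , refl
𝒫-rhs-constant (A⟶ _) (there ())
𝒫-rhs-constant (C⟶ _) (here refl) = _ , refl
𝒫-rhs-constant (C⟶ _) (there ())

𝒫-isPTRS : IsPTRS 𝒫
𝒫-isPTRS ρ Pρ = rhs-FDist Pρ , (_ , _ , proj₂ (𝒫-lhs-constant Pρ)) ,
  λ _ _ r∈ _ x∈r → ⊥-elim (ground (𝒫-rhs-constant Pρ r∈) x∈r)
  where
  0<½ : 0ℚ < ½
  0<½ = ℚP.positive⁻¹ ½
  ½≤1 : ½ ≤ 1ℚ
  ½≤1 = toWitness {a? = ½ ℚP.≤? 1ℚ} tt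
  0<1≤1 : (0ℚ < 1ℚ) × (1ℚ ≤ 1ℚ)
  0<1≤1 = ℚP.positive⁻¹ 1ℚ , ℚP.≤-refl
  rhs-FDist : ∀ {ρ} → 𝒫 ρ → IsFDist (rhs ρ)
  rhs-FDist Z⟶ = ((0<½ , ½≤1) ∷ (0<½ , ½≤1) ∷ []) , refl
  rhs-FDist (A⟶ _) = (0<1≤1 ∷ []) , refl
  rhs-FDist (C⟶ _) = (0<1≤1 ∷ []) , refl
  ground : ∀ {x u} → IsConstant u → ¬ x occursIn u
  ground (_ , refl) (there ())

𝒫-overConstants : OverSig Constants 𝒫
𝒫-overConstants ρ Pρ = constant∈𝒯 (𝒫-lhs-constant Pρ) , λ _ _ r∈ → constant∈𝒯 (𝒫-rhs-constant Pρ r∈)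
  where
  constant∈𝒯 : ∀ {u} → IsConstant u → u ∈𝒯 Constants
  constant∈𝒯 (f , refl) = wf-fun f [] refl []

𝒫-redex? : ∀ u → Dec (Redex 𝒫 u)
𝒫-redex? (var _) = no λ { (_ , Z⟶ , _ , ()) ; (_ , A⟶ _ , _ , ()) ; (_ , C⟶ _ , _ , ()) }
𝒫-redex? (fun 0 []) = yes (_ , Z⟶ , var , refl)
𝒫-redex? (fun 1 []) = yes (_ , A⟶ 0 , var , refl)
𝒫-redex? (fun 2 []) = no λ { (_ , Z⟶ , _ , ()) ; (_ , A⟶ _ , _ , ()) ; (_ , C⟶ _ , _ , ()) }
𝒫-redex? (fun (suc (suc (suc n))) []) = yes (_ , C⟶ n , var , refl)
𝒫-redex? (fun _ (_ ∷ _)) = no λ { (_ , Z⟶ , _ , ()) ; (_ , A⟶ _ , _ , ()) ; (_ , C⟶ _ , _ , ()) }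

𝒫-nf? : ∀ t → Dec (NF 𝒫 t)
𝒫-nf? = nf? 𝒫-redex?

reducible𝒫 : Term → ℚ
reducible𝒫 = reducible 𝒫-nf?

lhs-redex : ∀ {ρ} → 𝒫 ρ → Redex 𝒫 (lhs ρ)
lhs-redex Z⟶ = _ , Z⟶ , var , refl
lhs-redex (A⟶ n) = _ , A⟶ n , var , refl
lhs-redex (C⟶ n) = _ , C⟶ n , var , refl

root-reducible : ∀ {ρ} → 𝒫 ρ → reducible𝒫 (lhs ρ) ≡ 1ℚ
root-reducible Pρ = reducible-¬NF 𝒫-nf? (redexAt⇒¬NF {π = []} refl (lhs-redex Pρ))

data Atomic : Term → Set where
  var : ∀ {x} → Atomic (var x)
  const : ∀ {f} → Atomic (fun f [])

data AtomicNotA : Term → Set where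
  var : ∀ {x} → AtomicNotA (var x)
  isZ : AtomicNotA Z
  isC : ∀ n → AtomicNotA (C n)

AtomicNotA⇒Atomic : ∀ {t} → AtomicNotA t → Atomic t
AtomicNotA⇒Atomic var = var
AtomicNotA⇒Atomic isZ = const
AtomicNotA⇒Atomic (isC _) = const

Atomic-over-Constants : ∀ {t} → t ∈𝒯 Constants → Atomic t
Atomic-over-Constants (wf-var _) = var
Atomic-over-Constants (wf-fun _ [] _ _) = const

data AtomicStep : Term → MDist → Set where
  Z-step : AtomicStep Z ((½ , Z) ∷ (½ , C 0) ∷ [])
  A-step : ∀ n → AtomicStep A [ (1ℚ , C n) ]
  C-step : ∀ n → AtomicStep (C (suc n)) [ (1ℚ , C n) ]

atomicStep-inv : ∀ {s t ν} → Atomic t → Step s 𝒫 t ν → AtomicStep t ν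
atomicStep-inv var ([] , _ , _ , (Z⟶ , () , _) , _)
atomicStep-inv var ([] , _ , _ , (A⟶ _ , () , _) , _)
atomicStep-inv var ([] , _ , _ , (C⟶ _ , () , _) , _)
atomicStep-inv var ((_ ∷ _) , _ , _ , (_ , () , _) , _)
atomicStep-inv const ((_ ∷ _) , _ , _ , (_ , () , _) , _)
atomicStep-inv const ([] , _ , _ , (Z⟶ , refl , refl) , _) = Z-step
atomicStep-inv const ([] , _ , _ , (A⟶ n , refl , refl) , _) = A-step n
atomicStep-inv const ([] , _ , _ , (C⟶ n , refl , refl) , _) = C-step n

potential : Term → ℚ
potential (fun 0 []) = 1ℚ + 1ℚ
potential (fun (suc (suc n)) []) = n ×ℚ 1ℚ
potential _ = 0ℚ

potential-nonNeg : ∀ t → 0ℚ ≤ potential t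
potential-nonNeg (var _) = ℚP.≤-refl
potential-nonNeg (fun 0 []) = +-nonNeg 0≤1 0≤1
potential-nonNeg (fun 0 (_ ∷ _)) = ℚP.≤-refl
potential-nonNeg (fun 1 _) = ℚP.≤-refl
potential-nonNeg (fun (suc (suc n)) []) = ×ℚ-nonNeg n 0≤1
potential-nonNeg (fun (suc (suc _)) (_ ∷ _)) = ℚP.≤-refl

module _ {s : Strategy} where

  Lift-Atomic : ∀ {μ ν} → Lift s 𝒫 μ ν → AllTerms Atomic μ → AllTerms AtomicNotA ν
  Lift-Atomic = Lift-AllTerms nf-case step-case
    where
    nf-case : ∀ {t} → Atomic t → NF 𝒫 t → AtomicNotA t
    nf-case var _ = var
    nf-case (const {0}) _ = isZ
    nf-case (const {1}) nf = ⊥-elim (redexAt⇒¬NF {π = []} refl (lhs-redex (A⟶ 0)) nf)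
    nf-case (const {suc (suc n)}) _ = isC n
    step-case : ∀ {t ν} → Atomic t → Step s 𝒫 t ν → AllTerms AtomicNotA ν
    step-case a step with atomicStep-inv a step
    ... | Z-step = isZ ∷ isC 0 ∷ []
    ... | A-step n = isC n ∷ []
    ... | C-step n = isC n ∷ []

  Lift-potential : ∀ {μ ν} → Lift s 𝒫 μ ν → AllTerms AtomicNotA μ →
    𝔼 potential ν + 𝔼 reducible𝒫 μ ≤ 𝔼 potential μ
  Lift-potential = Lift-𝔼-decrease potential reducible𝒫 (λ _ → ℚP.≤-reflexive ∘ reducible-NF 𝒫-nf?) step-case
    where
    step-case : ∀ {t ν} → AtomicNotA t → Step s 𝒫 t ν → 𝔼 potential ν + reducible𝒫 t ≤ potential t
    step-case var step with atomicStep-inv var step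
    ... | ()
    step-case isZ step with atomicStep-inv const step
    ... | Z-step = ℚP.≤-reflexive (cong (𝔼 potential ((½ , Z) ∷ (½ , C 0) ∷ []) +_) (root-reducible Z⟶))
    step-case (isC _) step with atomicStep-inv const step
    ... | C-step n = ℚP.≤-reflexive
      (≡-trans (cong₂ _+_ (𝔼-singleton potential (C n)) (root-reducible (C⟶ n))) (ℚP.+-comm (n ×ℚ 1ℚ) 1ℚ))

-- The bound starts at μ 1: A ⟶ Cₙ for every n, so A has no finite potential.
Constants-PAST : ∀ s → PAST s 𝒫 Constants
Constants-PAST s t t∈𝒯 μ μ₀ lifts = 1ℚ + 𝔼 potential (μ 1) , bounded
  where
  atomic : ∀ n → AllTerms Atomic (μ n)
  atomic zero rewrite μ₀ = Atomic-over-Constants t∈𝒯 ∷ []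
  atomic (suc n) = All.map AtomicNotA⇒Atomic (Lift-Atomic (lifts n) (atomic n))

  bounded : ∀ q → (∀ n → NFMass 𝒫 (μ n) (q n)) → ∀ N → partialSum q N ≤ 1ℚ + 𝔼 potential (μ 1)
  bounded q nfMass = partialSum-≤-potential q (λ n → 𝔼 potential (μ n))
    (λ n → 𝔼-nonNeg potential (μ n) (Lift-nonNegProbs (lifts n)) potential-nonNeg) first decrease
    where
    open ℚP.≤-Reasoning
    unreduced : ∀ n → 1ℚ - q n ≡ 𝔼 reducible𝒫 (μ n)
    unreduced n = 1-NFMass≡𝔼reducible 𝒫-nf? (nfMass n)
      (sumP-along 𝒫-isPTRS lifts (cong sumP μ₀) n)
    first : 1ℚ - q 0 ≤ 1ℚ
    first = begin
      1ℚ - q 0                         ≡⟨ unreduced 0 ⟩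
      𝔼 reducible𝒫 (μ 0)               ≡⟨ cong (𝔼 reducible𝒫) μ₀ ⟩
      𝔼 reducible𝒫 [ (1ℚ , t) ]        ≡⟨ 𝔼-singleton reducible𝒫 t ⟩
      reducible𝒫 t                     ≤⟨ reducible-≤1 𝒫-nf? t ⟩
      1ℚ                               ∎
    decrease : ∀ n → 𝔼 potential (μ (suc (suc n))) + (1ℚ - q (suc n)) ≤ 𝔼 potential (μ (suc n))
    decrease n = begin
      𝔼 potential (μ (suc (suc n))) + (1ℚ - q (suc n))
        ≡⟨ cong (𝔼 potential (μ (suc (suc n))) +_) (unreduced (suc n)) ⟩
      𝔼 potential (μ (suc (suc n))) + 𝔼 reducible𝒫 (μ (suc n))
        ≤⟨ Lift-potential (lifts (suc n)) (Lift-Atomic (lifts n) (atomic n)) ⟩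
      𝔼 potential (μ (suc n)) ∎

gZA∈𝒯 : g Z A ∈𝒯 ConstantsAndBinary
gZA∈𝒯 = wf-fun 0 (Z ∷ A ∷ []) (inj₂ refl) (constant ∷ constant ∷ [])
  where
  constant : ∀ {f} → fun f [] ∈𝒯 ConstantsAndBinary
  constant = wf-fun _ [] (inj₁ refl) []

g-Z-step : ∀ {y} → Step 𝐥𝐢 𝒫 (g Z y) ((½ , g Z y) ∷ (½ , g (C 0) y) ∷ [])
g-Z-step = (0 ∷ []) , _ , var , (Z⟶ , refl , refl) , constant-ProperSubtermsNF 0 , NoRedexLeftOf-1st

C₀-NF : NF 𝒫 (C 0)
C₀-NF = toWitness {a? = 𝒫-nf? (C 0)} tt

g-A-step : ∀ n → Step 𝐥𝐢 𝒫 (g (C 0) A) [ (1ℚ , g (C 0) (C n)) ]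
g-A-step n = (1 ∷ []) , _ , var , (A⟶ n , refl , refl) , constant-ProperSubtermsNF 1 , NoRedexLeftOf-2nd C₀-NF

g-C-step : ∀ n → Step 𝐥𝐢 𝒫 (g (C 0) (C (suc n))) [ (1ℚ , g (C 0) (C n)) ]
g-C-step n = (1 ∷ []) , _ , var , (C⟶ n , refl , refl) , constant-ProperSubtermsNF _ , NoRedexLeftOf-2nd C₀-NF

fuel : ℕ → ℕ
fuel j = j ℕ.* 2 ^ suc j

offshootTerm : ℕ → ℕ → Term
offshootTerm j zero = g (C 0) A
offshootTerm j (suc a) = g (C 0) (C (fuel j ∸ a))

offshoot-reducible : ∀ j a → a ℕ.≤ fuel j → reducible𝒫 (offshootTerm j a) ≡ 1ℚ
offshoot-reducible j zero _ =
  reducible-¬NF 𝒫-nf? (redexAt⇒¬NF {t = g (C 0) A} {π = 1 ∷ []} refl (lhs-redex (A⟶ 0)))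
offshoot-reducible j (suc a) a<fuel with fuel j ∸ a | ℕP.m>n⇒m∸n≢0 a<fuel
... | zero | ≢0 = ⊥-elim (≢0 refl)
... | suc k | _ =
  reducible-¬NF 𝒫-nf? (redexAt⇒¬NF {t = g (C 0) (C (suc k))} {π = 1 ∷ []} refl (lhs-redex (C⟶ k)))

offshoots : ℕ → List (ℕ × ℕ)
offshoots zero = []
offshoots (suc n) = (n , 0) ∷ map (map₂ suc) (offshoots n)

data Branch : Set where
  root : Branch
  offshoot : ℕ → ℕ → Branch

branches : ℕ → List Branch
branches n = root ∷ map (uncurry offshoot) (offshoots n)

weight : ℕ → Branch → ℚ
weight n root = half^ n
weight n (offshoot j _) = half^ (suc j)

term : Branch → Term
term root = g Z A
term (offshoot j a) = offshootTerm j a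

next : Branch → MDist
next root = (½ , g Z A) ∷ (½ , g (C 0) A) ∷ []
next (offshoot j a) = [ (1ℚ , offshootTerm j (suc a)) ]

scheduled : ℕ → MDist
scheduled n = map (λ b → weight n b , term b) (branches n)

offshoot∈offshoots : ∀ j a → (j , a) ∈ offshoots (a ℕ.+ suc j)
offshoot∈offshoots j zero = here refl
offshoot∈offshoots j (suc a) = there (∈-map⁺ (map₂ suc) (offshoot∈offshoots j a))

offshoot∈scheduled : ∀ j a → (half^ (suc j) , offshootTerm j a) ∈ scheduled (a ℕ.+ suc j)
offshoot∈scheduled j a = there (∈-map⁺ _ (∈-map⁺ (uncurry offshoot) (offshoot∈offshoots j a)))

scheduled-next : ∀ n → concatMap (λ b → weight n b · next b) (branches n) ≡ scheduled (suc n)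
scheduled-next n = cong₂ _∷_ (cong (_, g Z A) (ℚP.*-comm (half^ n) ½))
  (cong₂ _∷_ (cong (_, g (C 0) A) (ℚP.*-comm (half^ n) ½)) (grown (offshoots n)))
  where
  grown : ∀ js → concatMap (λ b → weight n b · next b) (map (uncurry offshoot) js)
               ≡ map (λ b → weight (suc n) b , term b) (map (uncurry offshoot) (map (map₂ suc) js))
  grown [] = refl
  grown ((j , a) ∷ js) =
    cong₂ _∷_ (cong (_, offshootTerm j (suc a)) (ℚP.*-identityʳ (half^ (suc j)))) (grown js)

module _ (s : Strategy) where

  next-Lift : ∀ b → Lift s 𝒫 [ (1ℚ , term b) ] (next b)
  next-Lift root = lift-step (Step-𝐥𝐢⇒ s g-Z-step)
  next-Lift (offshoot j zero) = lift-step (Step-𝐥𝐢⇒ s (g-A-step (fuel j)))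
  next-Lift (offshoot j (suc a)) =
    subst (λ k → Lift s 𝒫 [ (1ℚ , g (C 0) (C (fuel j ∸ a))) ] [ (1ℚ , g (C 0) (C k)) ])
      (ℕP.pred[m∸n]≡m∸[1+n] (fuel j) a) (countdown (fuel j ∸ a))
    where
    countdown : ∀ k → Lift s 𝒫 [ (1ℚ , g (C 0) (C k)) ] [ (1ℚ , g (C 0) (C (ℕ.pred k))) ]
    countdown zero = lift-nf (toWitness {a? = 𝒫-nf? (g (C 0) (C 0))} tt)
    countdown (suc k) = lift-step (Step-𝐥𝐢⇒ s (g-C-step k))

  scheduled-Lift : ∀ n → Lift s 𝒫 (scheduled n) (scheduled (suc n))
  scheduled-sumP : ∀ n → sumP (scheduled n) ≡ 1ℚ
  scheduled-Lift n = subst (Lift s 𝒫 (scheduled n)) (scheduled-next n)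
    (Lift-mixture (branches n) (weight n) term next (All.tabulate λ {b} _ → weight-pos b)
      (scheduled-sumP n) (All.tabulate λ {b} _ → next-Lift b))
    where
    weight-pos : ∀ b → 0ℚ < weight n b
    weight-pos root = half^-pos n
    weight-pos (offshoot j _) = half^-pos (suc j)
  scheduled-sumP zero = refl
  scheduled-sumP (suc n) = ≡-trans (sym (Lift-sumP 𝒫-isPTRS (scheduled-Lift n))) (scheduled-sumP n)

fuel×weight : ∀ j → fuel j ×ℚ half^ (suc j) ≡ j ×ℚ 1ℚ
fuel×weight j = begin
  (j ℕ.* 2 ^ suc j) ×ℚ half^ (suc j)   ≡⟨ ×-assocˡ (half^ (suc j)) j (2 ^ suc j) ⟨
  j ×ℚ ((2 ^ suc j) ×ℚ half^ (suc j))  ≡⟨ cong (j ×ℚ_) (2^n×half^n (suc j)) ⟩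
  j ×ℚ 1ℚ                              ∎
  where open ≡-Reasoning

ConstantsAndBinary-¬PAST : ∀ s → ¬ PAST s 𝒫 ConstantsAndBinary
ConstantsAndBinary-¬PAST s past
  with past (g Z A) gZA∈𝒯 scheduled refl (scheduled-Lift s)
... | B , bounded = ℚP.<-irrefl refl (begin-strict
  B                                      ≤⟨ proj₂ (archimedean B) ⟩
  m ×ℚ 1ℚ                                ≡⟨ fuel×weight m ⟨
  fuel m ×ℚ half^ (suc m)                ≡⟨ ℚP.+-identityˡ _ ⟨
  0ℚ + fuel m ×ℚ half^ (suc m)           <⟨ ℚP.+-monoˡ-< (fuel m ×ℚ half^ (suc m)) (half^-pos (suc m)) ⟩
  suc (fuel m) ×ℚ half^ (suc m)          ≤⟨ partialSum-≥-plateau q (fuel m) (suc m) unreduced-nonNeg plateau ⟩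
  partialSum q (suc (fuel m) ℕ.+ suc m)  ≤⟨ bounded q (proj₂ ∘ NFMass-total 𝒫-nf? ∘ scheduled) N ⟩
  B                                      ∎)
  where
  open ℚP.≤-Reasoning
  m N : ℕ
  m = proj₁ (archimedean B)
  N = suc (fuel m) ℕ.+ suc m
  q : ℕ → ℚ
  q = proj₁ ∘ NFMass-total 𝒫-nf? ∘ scheduled
  unreduced : ∀ n → 1ℚ - q n ≡ 𝔼 reducible𝒫 (scheduled n)
  unreduced n = 1-NFMass≡𝔼reducible 𝒫-nf? (proj₂ (NFMass-total 𝒫-nf? (scheduled n))) (scheduled-sumP s n)
  unreduced-nonNeg : ∀ n → 0ℚ ≤ 1ℚ - q n
  unreduced-nonNeg n = subst (0ℚ ≤_) (sym (unreduced n))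
    (𝔼-nonNeg reducible𝒫 (scheduled n) (Lift-nonNegProbs (scheduled-Lift s n)) (reducible-nonNeg 𝒫-nf?))
  plateau : ∀ a → a ℕ.≤ fuel m → half^ (suc m) ≤ 1ℚ - q (a ℕ.+ suc m)
  plateau a a≤fuel = begin
    half^ (suc m)
      ≡⟨ ℚP.*-identityʳ _ ⟨
    half^ (suc m) * 1ℚ
      ≡⟨ cong (half^ (suc m) *_) (offshoot-reducible m a a≤fuel) ⟨
    half^ (suc m) * reducible𝒫 (offshootTerm m a)
      ≤⟨ 𝔼-≥-member reducible𝒫 _ (Lift-nonNegProbs (scheduled-Lift s _))
           (reducible-nonNeg 𝒫-nf?) (offshoot∈scheduled m a) ⟩
    𝔼 reducible𝒫 (scheduled (a ℕ.+ suc m))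
      ≡⟨ unreduced (a ℕ.+ suc m) ⟨
    1ℚ - q (a ℕ.+ suc m) ∎

theorem3p16 : ∀ (s : Strategy) → ∃ λ (P : PTRS) → ∃ λ (S : Signature) → ∃ λ (S' : Signature) →
    IsPTRS P × OverSig S P × S ⊊Sig S' × PAST s P S × ¬ PAST s P S'
theorem3p16 s = 𝒫 , Constants , ConstantsAndBinary , 𝒫-isPTRS , 𝒫-overConstants ,
  Constants⊊ConstantsAndBinary , Constants-PAST s , ConstantsAndBinary-¬PAST s
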